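{- Let $q\in\{1,2,3\}$, let $(G_k)_{k\ge0}$ be defined by $G_0=\dots=G_{q-2}=0$, $G_{q-1}=1$, $G_{k+q}=G_{k+q-1}+G_k$ ($k\ge0$). In the game described below, suppose a player X leaves a heap whose number of beans has least $G$-summand $G_\ell$, and the other player Y then removes $p$ beans with $1\le p<G_\ell$. Then it is a legal move for X to remove a number of beans equal to the least $G$-summand of $G_\ell-p$; that is, if $G_b$ denotes this least $G$-summand, then $G_b\le qp$ when $p=1$ or $q\in\{1,2\}$, and $G_b\le qp-1$ when $p\ge2$ and $q=3$.
   Context: Every integer $m\ge1$ has a unique representation $m=\sum_{i\ge0}\epsilon_i G_{2q-2+i}$ with $\epsilon_i\in\{0,1\}$ and $\epsilon_i+\dots+\epsilon_{i+q-1}\le1$ for all $i$ (its $q$-representation); the $G$-summands of $m$ are the terms $G_{2q-2+i}$ with $\epsilon_i=1$, and the least $G$-summand is the smallest of them. The game: a single heap of beans; two players alternately remove a positive number of beans; on the first move any number may be removed except the whole heap; if a player has just removed $p$ beans, the next player may remove $p'$ beans with $p'\le qp$ if $p=1$ or if $q\in\{1,2\}$, and $p'\le qp-1$ if $p\ge2$ and $q=3$. The player removing the last bean wins. -}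

module Defs where

open import Data.Nat using (ℕ; zero; suc; _+_; _*_; _∸_; _≤_; _<_)
open import Data.Bool using (Bool; true; false)
open import Data.List using (List; []; _∷_; length)
open import Data.Product using (Σ; ∃; _×_; _,_)
open import Data.Sum using (_⊎_)
open import Relation.Binary.PropositionalEquality using (_≡_)

G₁ : ℕ → ℕ
G₁ zero    = 1
G₁ (suc k) = G₁ k + G₁ k

G₂ : ℕ → ℕ
G₂ zero          = 0
G₂ (suc zero)    = 1
G₂ (suc (suc k)) = G₂ (suc k) + G₂ k

G₃ : ℕ → ℕ
G₃ zero                = 0
G₃ (suc zero)          = 0
G₃ (suc (suc zero))    = 1
G₃ (suc (suc (suc k))) = G₃ (suc (suc k)) + G₃ k

-- G q k; only meaningful for q ∈ {1,2,3} (other q give the junk value 0).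
G : ℕ → ℕ → ℕ
G 1 = G₁
G 2 = G₂
G 3 = G₃
G _ = λ _ → 0

QOk : ℕ → Set
QOk q = (q ≡ 1) ⊎ (q ≡ 2) ⊎ (q ≡ 3)

-- A digit string ε = (ε_0, ε_1, …) with finite support, given as a list of
-- bits; ε_i = 0 beyond the end of the list.
bit : List Bool → ℕ → ℕ
bit []          _       = 0
bit (true ∷ _)  zero    = 1
bit (false ∷ _) zero    = 0
bit (_ ∷ ε)     (suc i) = bit ε i

window : List Bool → ℕ → ℕ → ℕ
window ε i zero    = 0
window ε i (suc k) = bit ε i + window ε (suc i) k

valueFrom : ℕ → ℕ → List Bool → ℕ
valueFrom q s []          = 0
valueFrom q s (true ∷ ε)  = G q (2 * q ∸ 2 + s) + valueFrom q (suc s) ε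
valueFrom q s (false ∷ ε) = valueFrom q (suc s) ε

value : ℕ → List Bool → ℕ
value q ε = valueFrom q 0 ε

IsQRep : ℕ → ℕ → List Bool → Set
IsQRep q m ε = (m ≡ value q ε) × (∀ i → window ε i q ≤ 1)

LeastSummandIdx : ℕ → ℕ → ℕ → Set
LeastSummandIdx q m ℓ =
  Σ (List Bool) λ ε → IsQRep q m ε ×
    Σ ℕ λ i → (bit ε i ≡ 1) × (∀ j → j < i → bit ε j ≡ 0) × (ℓ ≡ 2 * q ∸ 2 + i)

-- After a move removing p beans, the next player may remove p' beans iff
-- 1 ≤ p' ≤ maxNext q p.
maxNext : ℕ → ℕ → ℕ
maxNext 3 (suc (suc p)) = 3 * suc (suc p) ∸ 1
maxNext q p             = q * p

-- Let X = G_ℓ − p have least G-summand G_b.  Every valid representation of a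
-- number X < G_ℓ satisfies X + G_{b−q+1} ≤ G_ℓ: reading the digits from the
-- lowest one upward, the summands above G_b start at least q places higher,
-- so inductively they leave room for G_{b+1} = G_b + G_{b−q+1} below G_ℓ.
-- Hence G_{b−q+1} ≤ G_ℓ − X = p, and G_b ≤ q·G_{b−q+1} ≤ qp.  For q = 3 the
-- inequality G_b ≤ 3·G_{b−2} is strict unless G_b ≤ 3, which gives 3p − 1.
module Submission where

open import Defs
open import Data.Nat
  using (ℕ; zero; suc; _+_; _*_; _∸_; _≤_; _<_; _≤′_; ≤′-refl; ≤′-step; z≤n; s≤s; z<s; _≤?_)
open import Data.Nat.Properties
open import Data.Bool using (Bool; true; false)
open import Data.List using (List; []; _∷_)
open import Data.Product using (Σ; _×_; _,_)
open import Data.Sum using (inj₁; inj₂)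
open import Data.Empty using (⊥-elim)
open import Relation.Nullary using (yes; no)
open import Relation.Binary.PropositionalEquality
  using (_≡_; refl; sym; trans; cong; cong₂; subst; module ≡-Reasoning)
open import Algebra.Properties.CommutativeSemigroup +-commutativeSemigroup using (xy∙z≈y∙xz)

module _ {f : ℕ → ℕ} (f-step : ∀ k → f k ≤ f (suc k)) where

  step⇒mono : ∀ {a b} → a ≤ b → f a ≤ f b
  step⇒mono a≤b = mono′ (≤⇒≤′ a≤b)
    where
    mono′ : ∀ {a b} → a ≤′ b → f a ≤ f b
    mono′ ≤′-refl       = ≤-refl
    mono′ (≤′-step a≤b) = ≤-trans (mono′ a≤b) (f-step _)

  step⇒f[1+a]≤f[b] : ∀ {a b} → f a < f b → f (suc a) ≤ f b
  step⇒f[1+a]≤f[b] {a} {b} fa<fb with b ≤? a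
  ... | yes b≤a = ⊥-elim (<⇒≱ fa<fb (step⇒mono b≤a))
  ... | no  b≰a = step⇒mono (≰⇒> b≰a)

G-step : ∀ {q} → QOk q → ∀ k → G q k ≤ G q (suc k)
G-step (inj₁ refl)        k             = m≤m+n (G₁ k) (G₁ k)
G-step (inj₂ (inj₁ refl)) zero          = z≤n
G-step (inj₂ (inj₁ refl)) (suc k)       = m≤m+n (G₂ (suc k)) (G₂ k)
G-step (inj₂ (inj₂ refl)) zero          = z≤n
G-step (inj₂ (inj₂ refl)) (suc zero)    = z≤n
G-step (inj₂ (inj₂ refl)) (suc (suc k)) = m≤m+n (G₃ (suc (suc k))) (G₃ k)

G-rec : ∀ {r} → QOk (suc r) → ∀ k → G (suc r) (suc r + k) ≡ G (suc r) (r + k) + G (suc r) k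
G-rec (inj₁ refl)        k = refl
G-rec (inj₂ (inj₁ refl)) k = refl
G-rec (inj₂ (inj₂ refl)) k = refl

Valid : ℕ → List Bool → Set
Valid q ε = ∀ i → window ε i q ≤ 1

LeadingZeros : ℕ → List Bool → Set
LeadingZeros k ε = ∀ j → j < k → bit ε j ≡ 0

window-∷ : ∀ x ε i k → window (x ∷ ε) (suc i) k ≡ window ε i k
window-∷ x     ε i zero    = refl
window-∷ true  ε i (suc k) = cong (bit ε i +_) (window-∷ true  ε (suc i) k)
window-∷ false ε i (suc k) = cong (bit ε i +_) (window-∷ false ε (suc i) k)

Valid-∷⁻ : ∀ {q} x ε → Valid q (x ∷ ε) → Valid q ε
Valid-∷⁻ {q} x ε valid i = subst (_≤ 1) (window-∷ x ε i q) (valid (suc i))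

window≡0⇒LeadingZeros : ∀ ε k → window ε 0 k ≡ 0 → LeadingZeros k ε
window≡0⇒LeadingZeros []          k       w≡0 j       j<k       = refl
window≡0⇒LeadingZeros (x ∷ ε)     (suc k) w≡0 zero    _         = m+n≡0⇒m≡0 (bit (x ∷ ε) 0) w≡0
window≡0⇒LeadingZeros (true ∷ ε)  (suc k) w≡0 (suc j) (s≤s j<k) =
  window≡0⇒LeadingZeros ε k (trans (sym (window-∷ true ε 0 k)) (m+n≡0⇒n≡0 1 w≡0)) j j<k
window≡0⇒LeadingZeros (false ∷ ε) (suc k) w≡0 (suc j) (s≤s j<k) =
  window≡0⇒LeadingZeros ε k (trans (sym (window-∷ false ε 0 k)) w≡0) j j<k

Valid-true∷⇒LeadingZeros : ∀ {r} ε → Valid (suc r) (true ∷ ε) → LeadingZeros r ε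
Valid-true∷⇒LeadingZeros {r} ε valid = window≡0⇒LeadingZeros ε r
  (trans (sym (window-∷ true ε 0 r)) (n≤0⇒n≡0 (≤-pred (valid 0))))

2*[1+r]∸2+s≡r+[r+s] : ∀ r s → 2 * suc r ∸ 2 + s ≡ r + (r + s)
2*[1+r]∸2+s≡r+[r+s] r s = begin
  2 * suc r ∸ 2 + s   ≡⟨ cong (λ m → m ∸ 2 + s) (*-suc 2 r) ⟩
  r + (r + 0) + s     ≡⟨ cong (λ m → r + m + s) (+-identityʳ r) ⟩
  r + r + s           ≡⟨ +-assoc r r s ⟩
  r + (r + s)         ∎
  where open ≡-Reasoning

m∸n+o≤m⇒o≤n : ∀ {m n o} → n ≤ m → m ∸ n + o ≤ m → o ≤ n
m∸n+o≤m⇒o≤n {m} {n} {o} n≤m h = +-cancelˡ-≤ (m ∸ n) o n (subst (m ∸ n + o ≤_) (sym (m∸n+n≡m n≤m)) h)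

r+[1+s+r]≡1+r+[r+s] : ∀ r s → r + (suc s + r) ≡ suc r + (r + s)
r+[1+s+r]≡1+r+[r+s] r s = trans (+-suc r (s + r)) (cong (λ m → suc (r + m)) (+-comm s r))

module _ {r : ℕ} (ok : QOk (suc r)) {ℓ : ℕ} where

  private
    g : ℕ → ℕ
    g = G (suc r)

  w+G≤G-from-positive : ∀ t w → (0 < w → w < g ℓ → w + g (suc r + t) ≤ g ℓ) →
                        g (r + t) + w < g ℓ → w + g (suc r + t) ≤ g ℓ
  w+G≤G-from-positive t zero    _        gt+0<gℓ =
    step⇒f[1+a]≤f[b] (G-step ok) (subst (_< g ℓ) (+-identityʳ (g (r + t))) gt+0<gℓ)
  w+G≤G-from-positive t (suc w) w+g≤gℓ gt+w<gℓ =
    w+g≤gℓ z<s (≤-<-trans (m≤n+m (suc w) (g (r + t))) gt+w<gℓ)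

  -- With q = suc r, the least summand has index at least 2q−2+s+k = r+(r+(s+k)),
  -- and the added G sits q−1 places below that bound.
  valueFrom+G≤G : ∀ ε s k → Valid (suc r) ε → LeadingZeros k ε →
                  0 < valueFrom (suc r) s ε → valueFrom (suc r) s ε < g ℓ →
                  valueFrom (suc r) s ε + g (r + (s + k)) ≤ g ℓ
  valueFrom+G≤G []          s k _ _ () _
  valueFrom+G≤G (false ∷ ε) s zero valid _ v>0 v<gℓ =
    ≤-trans (+-monoʳ-≤ (valueFrom (suc r) (suc s) ε)
                       (step⇒mono (G-step ok) (+-monoʳ-≤ r (n≤1+n (s + 0)))))
            (valueFrom+G≤G ε (suc s) zero (Valid-∷⁻ {suc r} false ε valid) (λ _ ()) v>0 v<gℓ)
  valueFrom+G≤G (false ∷ ε) s (suc k) valid zeros v>0 v<gℓ =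
    subst (λ m → valueFrom (suc r) (suc s) ε + g (r + m) ≤ g ℓ) (sym (+-suc s k))
      (valueFrom+G≤G ε (suc s) k (Valid-∷⁻ {suc r} false ε valid)
        (λ j j<k → zeros (suc j) (s≤s j<k)) v>0 v<gℓ)
  valueFrom+G≤G (true ∷ ε) s (suc k) _ zeros _ _ with () ← zeros 0 z<s
  valueFrom+G≤G (true ∷ ε) s zero valid _ _ v<gℓ = begin
    g (2 * suc r ∸ 2 + s) + w + g (r + (s + 0))
      ≡⟨ cong₂ (λ a b → g a + w + g (r + b)) (2*[1+r]∸2+s≡r+[r+s] r s) (+-identityʳ s) ⟩
    g (r + t) + w + g t                ≡⟨ xy∙z≈y∙xz (g (r + t)) w (g t) ⟩
    w + (g (r + t) + g t)              ≡⟨ cong (w +_) (sym (G-rec ok t)) ⟩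
    w + g (suc r + t)                  ≤⟨ w+G≤G-from-positive t w above gt+w<gℓ ⟩
    g ℓ                                ∎
    where
    open ≤-Reasoning
    w = valueFrom (suc r) (suc s) ε
    t = r + s
    gt+w<gℓ : g (r + t) + w < g ℓ
    gt+w<gℓ = subst (λ a → g a + w < g ℓ) (2*[1+r]∸2+s≡r+[r+s] r s) v<gℓ
    above : 0 < w → w < g ℓ → w + g (suc r + t) ≤ g ℓ
    above w>0 w<gℓ =
      subst (λ m → w + g m ≤ g ℓ) (r+[1+s+r]≡1+r+[r+s] r s)
        (valueFrom+G≤G ε (suc s) r (Valid-∷⁻ {suc r} true ε valid)
          (Valid-true∷⇒LeadingZeros ε valid) w>0 w<gℓ)

  leastSummand[G∸p]⇒G≤p : ∀ {p b} → 1 ≤ p → p < g ℓ → LeastSummandIdx (suc r) (g ℓ ∸ p) b →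
                          Σ ℕ λ i → (b ≡ 2 * suc r ∸ 2 + i) × (g (r + i) ≤ p)
  leastSummand[G∸p]⇒G≤p {p} 1≤p p<gℓ (ε , (x≡v , valid) , i , _ , zeros , b≡) =
    i , b≡ , m∸n+o≤m⇒o≤n (<⇒≤ p<gℓ)
      (subst (λ x → x + g (r + i) ≤ g ℓ) (sym x≡v)
        (valueFrom+G≤G ε 0 i valid zeros
          (subst (0 <_) x≡v (m<n⇒0<n∸m p<gℓ))
          (subst (_< g ℓ) x≡v (∸-monoʳ-< 1≤p (<⇒≤ p<gℓ)))))

G₁[i]≤p⇒G₁[i]≤maxNext : ∀ i {p} → G₁ i ≤ p → G₁ i ≤ maxNext 1 p
G₁[i]≤p⇒G₁[i]≤maxNext i {p} h = ≤-trans h (≤-reflexive (sym (*-identityˡ p)))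

G₂[1+i]≤p⇒G₂[2+i]≤maxNext : ∀ i {p} → G₂ (1 + i) ≤ p → G₂ (2 + i) ≤ maxNext 2 p
G₂[1+i]≤p⇒G₂[2+i]≤maxNext i {p} h = begin
  G₂ (1 + i) + G₂ i  ≤⟨ +-mono-≤ h (≤-trans (G-step (inj₂ (inj₁ refl)) i) h) ⟩
  p + p              ≡⟨ cong (p +_) (sym (+-identityʳ p)) ⟩
  2 * p              ∎
  where open ≤-Reasoning

1≤G₃[2+k] : ∀ k → 1 ≤ G₃ (2 + k)
1≤G₃[2+k] k = step⇒mono (G-step (inj₂ (inj₂ refl))) (m≤m+n 2 k)

1+G₃[7+k]≤3*G₃[5+k] : ∀ k → suc (G₃ (7 + k)) ≤ 3 * G₃ (5 + k)
1+G₃[7+k]≤3*G₃[5+k] k = begin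
  suc (a + b + c)  ≡⟨ sym (+-suc (a + b) c) ⟩
  a + b + suc c    ≤⟨ +-mono-≤ (+-monoʳ-≤ a b≤a) (m<m+n c (1≤G₃[2+k] k)) ⟩
  a + a + a        ≡⟨ trans (+-assoc a a a) (cong (λ x → a + (a + x)) (sym (+-identityʳ a))) ⟩
  3 * a            ∎
  where
  open ≤-Reasoning
  a = G₃ (5 + k)
  b = G₃ (3 + k)
  c = G₃ (4 + k)
  b≤a : b ≤ a
  b≤a = step⇒mono (G-step (inj₂ (inj₂ refl))) (m≤n+m (3 + k) 2)

3≤maxNext : ∀ {p} → 1 ≤ p → 3 ≤ maxNext 3 p
3≤maxNext {1}           _ = ≤-refl
3≤maxNext {suc (suc p)} _ = ≤-trans (m≤n+m 3 2) (∸-monoˡ-≤ 1 (*-monoʳ-≤ 3 (m≤m+n 2 p)))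

1+m≤3*p⇒m≤maxNext : ∀ {m p} → 1 ≤ p → suc m ≤ 3 * p → m ≤ maxNext 3 p
1+m≤3*p⇒m≤maxNext {m} {1}           _ h = ≤-trans (n≤1+n m) h
1+m≤3*p⇒m≤maxNext {m} {suc (suc p)} _ h = suc[m]≤n⇒m≤pred[n] h

G₃[2+i]≤p⇒G₃[4+i]≤maxNext : ∀ i {p} → 1 ≤ p → G₃ (2 + i) ≤ p → G₃ (4 + i) ≤ maxNext 3 p
G₃[2+i]≤p⇒G₃[4+i]≤maxNext 0             1≤p _ = ≤-trans (s≤s z≤n) (3≤maxNext 1≤p)
G₃[2+i]≤p⇒G₃[4+i]≤maxNext 1             1≤p _ = ≤-trans (s≤s (s≤s z≤n)) (3≤maxNext 1≤p)
G₃[2+i]≤p⇒G₃[4+i]≤maxNext 2             1≤p _ = 3≤maxNext 1≤p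
G₃[2+i]≤p⇒G₃[4+i]≤maxNext (suc (suc (suc k))) 1≤p h =
  1+m≤3*p⇒m≤maxNext 1≤p (≤-trans (1+G₃[7+k]≤3*G₃[5+k] k) (*-monoʳ-≤ 3 h))

lemma2 : (q n ℓ p b : ℕ) → QOk q →
         LeastSummandIdx q n ℓ →
         1 ≤ p → p < G q ℓ →
         LeastSummandIdx q (G q ℓ ∸ p) b →
         G q b ≤ maxNext q p
lemma2 q n ℓ p b ok@(inj₁ refl) _ 1≤p p<G least with leastSummand[G∸p]⇒G≤p ok {ℓ} 1≤p p<G least
... | i , refl , gap = G₁[i]≤p⇒G₁[i]≤maxNext i gap
lemma2 q n ℓ p b ok@(inj₂ (inj₁ refl)) _ 1≤p p<G least with leastSummand[G∸p]⇒G≤p ok {ℓ} 1≤p p<G least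
... | i , refl , gap = G₂[1+i]≤p⇒G₂[2+i]≤maxNext i gap
lemma2 q n ℓ p b ok@(inj₂ (inj₂ refl)) _ 1≤p p<G least with leastSummand[G∸p]⇒G≤p ok {ℓ} 1≤p p<G least
... | i , refl , gap = G₃[2+i]≤p⇒G₃[4+i]≤maxNext i 1≤p gap
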